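{- Let $G$ be a 3-connected graph and let $\{A,B\}$ be a proper separation of $G$ of order $3$. Then exactly one of the following holds: (C1) one of $G[A]$, $G[B]$ is a claw $K_{1,3}$ whose set of leaves is $A\cap B$, while the other includes a cycle; (C2) both $G[A]$ and $G[B]$ include cycles.
   Context: All graphs are finite and simple. A separation of $G$ is a set $\{A,B\}$ with $A\cup B=V(G)$ and no edge between $A\setminus B$ and $B\setminus A$; its order is $|A\cap B|$. It is proper if $A\setminus B\ne\emptyset\ne B\setminus A$. -}

module Defs where

open import Data.Nat using (ℕ; zero; suc; _<_; _≥_)
open import Data.Bool using (Bool; true; false)
open import Data.Fin using (Fin; zero; suc; inject₁; fromℕ)
open import Data.Fin.Subset using (Subset; _∈_; _∉_; _∩_; _∪_; ∣_∣; ⊤)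
open import Data.Product using (Σ; ∃; _×_; _,_)
open import Data.Sum using (_⊎_)
open import Relation.Nullary using (¬_)
open import Relation.Binary.PropositionalEquality using (_≡_; _≢_)
open import Function.Definitions using (Injective)

record Graph (n : ℕ) : Set where
  field
    adj   : Fin n → Fin n → Bool
    sym   : ∀ u v → adj u v ≡ adj v u
    irref : ∀ v → adj v v ≡ false

open Graph public

Adj : ∀ {n} → Graph n → Fin n → Fin n → Set
Adj G u v = adj G u v ≡ true

data WalkAvoiding {n} (G : Graph n) (X : Subset n) : Fin n → Fin n → Set where
  here : ∀ {u} → u ∉ X → WalkAvoiding G X u u
  step : ∀ {u w v} → u ∉ X → Adj G u w → WalkAvoiding G X w v → WalkAvoiding G X u v

ConnectedMinus : ∀ {n} → Graph n → Subset n → Set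
ConnectedMinus G X = ∀ u v → u ∉ X → v ∉ X → WalkAvoiding G X u v

KConnected : ∀ {n} → ℕ → Graph n → Set
KConnected {n} k G = k < n × (∀ (X : Subset n) → ∣ X ∣ < k → ConnectedMinus G X)

IsSeparation : ∀ {n} → Graph n → Subset n → Subset n → Set
IsSeparation G A B =
  (A ∪ B ≡ ⊤) ×
  (∀ u v → u ∈ A → u ∉ B → v ∈ B → v ∉ A → ¬ Adj G u v)

order : ∀ {n} → Subset n → Subset n → ℕ
order A B = ∣ A ∩ B ∣

IsProper : ∀ {n} → Subset n → Subset n → Set
IsProper A B = (∃ λ x → x ∈ A × x ∉ B) × (∃ λ y → y ∈ B × y ∉ A)

IsClawWithLeaves : ∀ {n} → Graph n → Subset n → Subset n → Set
IsClawWithLeaves {n} G A L =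
  ∣ L ∣ ≡ 3 ×
  Σ (Fin n) λ c →
    c ∉ L ×
    (∀ x → x ∈ A → (x ≡ c ⊎ x ∈ L)) ×
    c ∈ A × (∀ x → x ∈ L → x ∈ A) ×
    (∀ x y → x ∈ A → y ∈ A →
       (Adj G x y → ((x ≡ c × y ∈ L) ⊎ (y ≡ c × x ∈ L))) ×
       (((x ≡ c × y ∈ L) ⊎ (y ≡ c × x ∈ L)) → Adj G x y))

HasCycleIn : ∀ {n} → Graph n → Subset n → Set
HasCycleIn {n} G A =
  Σ ℕ λ k → k ≥ 2 × Σ (Fin (suc k) → Fin n) λ f →
    Injective _≡_ _≡_ f ×
    (∀ i → f i ∈ A) ×
    (∀ (i : Fin k) → Adj G (f (inject₁ i)) (f (suc i))) ×
    Adj G (f (fromℕ k)) (f zero)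

module Submission where

-- Every separator vertex s has a neighbour in A ∖ B, because
-- G - (S - s) is connected. If A ∖ B = {x}, then x is adjacent to all of S = A ∩ B, so G[A] is a
-- claw centred at x unless an edge inside S closes a triangle. If A ∖ B has two vertices, delete
-- the leaves of G[A]: they lie in S, and no vertex v of A ∖ B carries two of them, since v and the
-- third separator vertex would separate the rest of A ∖ B from B ∖ A. As vertices of A ∖ B have
-- degree at least 3, the remaining graph has minimum degree 2 and so contains a cycle (found by a
-- non-backtracking walk). Finally, a claw has no cycle, and G[A], G[B] cannot both be claws: a
-- separator vertex would then have only the two centres as neighbours.

open import Defs hiding (sym)
open import Data.Nat using (ℕ; zero; suc; _+_; _≤_; _<_; z≤n; s≤s)
open import Data.Nat.Properties
  using (≤-trans; ≤-reflexive; ≤-pred; n≤1+n; n<1+n; <-cmp; <⇒≱; m≤n⇒∃[o]m+o≡n;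
         +-suc; +-identityʳ; +-mono-≤; +-monoʳ-≤; +-monoʳ-<)
open import Data.Nat.Induction using (<-rec)
open import Data.Fin using (Fin; zero; suc; toℕ; fromℕ; fromℕ<; inject₁)
open import Data.Fin.Properties
  using (_≟_; any?; pigeonhole; toℕ<n; toℕ-fromℕ<; toℕ-inject₁; toℕ-fromℕ; toℕ-injective)
open import Data.Fin.Subset
  using (Subset; inside; outside; _∈_; _∉_; _⊆_; _∩_; _∪_; _-_; ∣_∣; ⊤; ⁅_⁆) renaming (⊥ to ∅)
open import Data.Fin.Subset.Properties
  using (_∈?_; ∈⊤; ∣⊤∣≡n; ∣⊥∣≡0; x∈⁅x⁆; x∈⁅y⁆⇒x≡y; ∣⁅x⁆∣≡1; x∈p∪q⁺; x∈p∪q⁻; x∈p∩q⁺; p∩q⊆p; p∩q⊆q;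
         ∩-comm; ∪-comm; p⊆q⇒∣p∣≤∣q∣; p─q⊆p; x∈p∧x≢y⇒x∈p-y; x∈p⇒∣p-x∣<∣p∣)
open import Data.Bool using (true)
open import Data.Bool.Properties using () renaming (_≟_ to _≟ᵇ_)
open import Data.Vec using (_∷_; []; there)
open import Data.Product using (∃; _×_; _,_; proj₁; proj₂)
open import Data.Sum using (_⊎_; inj₁; inj₂)
import Data.Sum as Sum
open import Data.Empty using (⊥; ⊥-elim)
open import Function using (_∘_)
open import Relation.Nullary using (¬_; Dec; yes; no; contradiction)
open import Relation.Nullary.Decidable using (_×-dec_; ¬?; decidable-stable)
open import Relation.Binary using (tri<; tri≈; tri>)
open import Relation.Binary.PropositionalEquality using (_≡_; _≢_; refl; sym; trans; cong; cong₂; subst; subst₂)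

∣p∪q∣≤∣p∣+∣q∣ : ∀ {n} (p q : Subset n) → ∣ p ∪ q ∣ ≤ ∣ p ∣ + ∣ q ∣
∣p∪q∣≤∣p∣+∣q∣ []            []            = z≤n
∣p∪q∣≤∣p∣+∣q∣ (inside  ∷ p) (inside  ∷ q) = s≤s (≤-trans (∣p∪q∣≤∣p∣+∣q∣ p q) (+-monoʳ-≤ ∣ p ∣ (n≤1+n _)))
∣p∪q∣≤∣p∣+∣q∣ (inside  ∷ p) (outside ∷ q) = s≤s (∣p∪q∣≤∣p∣+∣q∣ p q)
∣p∪q∣≤∣p∣+∣q∣ (outside ∷ p) (inside  ∷ q) =
  subst (suc ∣ p ∪ q ∣ ≤_) (sym (+-suc ∣ p ∣ ∣ q ∣)) (s≤s (∣p∪q∣≤∣p∣+∣q∣ p q))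
∣p∪q∣≤∣p∣+∣q∣ (outside ∷ p) (outside ∷ q) = ∣p∪q∣≤∣p∣+∣q∣ p q

x∉p-x : ∀ {n} (p : Subset n) x → x ∉ p - x
x∉p-x (_ ∷ p) zero    ()
x∉p-x (_ ∷ p) (suc x) (there x∈p-x) = x∉p-x p x x∈p-x

∣q∣<∣p∣⇒p⊈q : ∀ {n} (p q : Subset n) → ∣ q ∣ < ∣ p ∣ → ∃ λ x → x ∈ p × x ∉ q
∣q∣<∣p∣⇒p⊈q p q ∣q∣<∣p∣ with any? (λ x → (x ∈? p) ×-dec ¬? (x ∈? q))
... | yes witness = witness
... | no none = contradiction (p⊆q⇒∣p∣≤∣q∣ p⊆q) (<⇒≱ ∣q∣<∣p∣)
  where
  p⊆q : p ⊆ q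
  p⊆q {x} x∈p = decidable-stable (x ∈? q) (λ x∉q → none (x , x∈p , x∉q))

p∪q≡⊤⇒x∈p⊎x∈q : ∀ {n} {p q : Subset n} → p ∪ q ≡ ⊤ → ∀ x → x ∈ p ⊎ x ∈ q
p∪q≡⊤⇒x∈p⊎x∈q {p = p} {q} p∪q≡⊤ x = x∈p∪q⁻ p q (subst (x ∈_) (sym p∪q≡⊤) ∈⊤)

pair : ∀ {n} → Fin n → Fin n → Subset n
pair x y = ⁅ x ⁆ ∪ ⁅ y ⁆

∣pair∣≤2 : ∀ {n} (x y : Fin n) → ∣ pair x y ∣ ≤ 2
∣pair∣≤2 x y = ≤-trans (∣p∪q∣≤∣p∣+∣q∣ ⁅ x ⁆ ⁅ y ⁆) (≤-reflexive (cong₂ _+_ (∣⁅x⁆∣≡1 x) (∣⁅x⁆∣≡1 y)))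

∈pairˡ : ∀ {n} (x y : Fin n) → x ∈ pair x y
∈pairˡ x y = x∈p∪q⁺ (inj₁ (x∈⁅x⁆ x))

∈pairʳ : ∀ {n} (x y : Fin n) → y ∈ pair x y
∈pairʳ x y = x∈p∪q⁺ (inj₂ (x∈⁅x⁆ y))

module _ {n} (G : Graph n) where

  Adj-sym : ∀ {u v} → Adj G u v → Adj G v u
  Adj-sym {u} {v} u~v = trans (Graph.sym G v u) u~v

  Adj-irrefl : ∀ {v} → ¬ Adj G v v
  Adj-irrefl {v} v~v with trans (sym v~v) (irref G v)
  ... | ()

  Adj⇒≢ : ∀ {u v} → Adj G u v → u ≢ v
  Adj⇒≢ u~v refl = Adj-irrefl u~v

  walk-head∉ : ∀ {X u v} → WalkAvoiding G X u v → u ∉ X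
  walk-head∉ (here u∉X)     = u∉X
  walk-head∉ (step u∉X _ _) = u∉X

  walk-first-step : ∀ {X u v} → WalkAvoiding G X u v → u ≢ v → ∃ λ w → Adj G u w × w ∉ X
  walk-first-step (here _)                  u≢u = contradiction refl u≢u
  walk-first-step (step {w = w} _ u~w rest) _   = w , u~w , walk-head∉ rest

  -- Minimum degree at least 3: v and a vertex b outside {v, u, u'} are joined in G - ({u, u'} - v),
  -- and the first step of such a walk avoids u and u'.
  neighbour-avoiding : KConnected 3 G → ∀ v u u' → ∃ λ w → Adj G v w × w ≢ u × w ≢ u'
  neighbour-avoiding (3<n , conn) v u u' =
    let b , _ , b∉v,u,u' = ∣q∣<∣p∣⇒p⊈q ⊤ (⁅ v ⁆ ∪ pair u u') ∣v,u,u'∣<n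
        w , v~w , w∉X = walk-first-step
          (conn X ∣X∣<3 v b (x∉p-x (pair u u') v) (b∉v,u,u' ∘ x∈p∪q⁺ ∘ inj₂ ∘ p─q⊆p (pair u u') ⁅ v ⁆))
          (λ v≡b → b∉v,u,u' (subst (_∈ ⁅ v ⁆ ∪ pair u u') v≡b (x∈p∪q⁺ (inj₁ (x∈⁅x⁆ v)))))
        w≢ : ∀ {t} → t ∈ pair u u' → w ≢ t
        w≢ = λ { t∈ refl → w∉X (x∈p∧x≢y⇒x∈p-y t∈ (Adj⇒≢ v~w ∘ sym)) }
    in w , v~w , w≢ (∈pairˡ u u') , w≢ (∈pairʳ u u')
    where
    X : Subset n
    X = pair u u' - v
    ∣X∣<3 : ∣ X ∣ < 3
    ∣X∣<3 = s≤s (≤-trans (p⊆q⇒∣p∣≤∣q∣ (p─q⊆p (pair u u') ⁅ v ⁆)) (∣pair∣≤2 u u'))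
    ∣v,u,u'∣<n : ∣ ⁅ v ⁆ ∪ pair u u' ∣ < ∣ ⊤ {n} ∣
    ∣v,u,u'∣<n = subst (∣ ⁅ v ⁆ ∪ pair u u' ∣ <_) (sym (∣⊤∣≡n n)) (≤-trans (s≤s ∣v,u,u'∣≤3) 3<n)
      where
      ∣v,u,u'∣≤3 : ∣ ⁅ v ⁆ ∪ pair u u' ∣ ≤ 3
      ∣v,u,u'∣≤3 = ≤-trans (∣p∪q∣≤∣p∣+∣q∣ ⁅ v ⁆ (pair u u')) (+-mono-≤ (≤-reflexive (∣⁅x⁆∣≡1 v)) (∣pair∣≤2 u u'))

  adj? : ∀ u v → Dec (Adj G u v)
  adj? u v = adj G u v ≟ᵇ true

  TwoNeighboursIn : (Fin n → Set) → Fin n → Set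
  TwoNeighboursIn P v = ∀ u → ∃ λ w → P w × Adj G v w × w ≢ u

  two-neighbours : ∀ {P : Fin n → Set} {v w w'} → P w → Adj G v w → P w' → Adj G v w' → w ≢ w' →
                   TwoNeighboursIn P v
  two-neighbours {w = w} w∈P v~w w'∈P v~w' w≢w' u with w ≟ u
  ... | yes refl = _ , w'∈P , v~w' , w≢w' ∘ sym
  ... | no w≢u   = w , w∈P , v~w , w≢u

  StarIn : Subset n → Fin n → Set
  StarIn A c = ∀ {x y} → x ∈ A → y ∈ A → Adj G x y → x ≡ c ⊎ y ≡ c

  module _ {A : Subset n} where

    triangle⇒cycle : ∀ {u v w} → u ∈ A → v ∈ A → w ∈ A → Adj G u v → Adj G v w → Adj G w u → HasCycleIn G A
    triangle⇒cycle {u} {v} {w} u∈A v∈A w∈A u~v v~w w~u = 2 , s≤s (s≤s z≤n) , g , g-injective , g∈A , g-adj , w~u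
      where
      g : Fin 3 → Fin n
      g zero             = u
      g (suc zero)       = v
      g (suc (suc zero)) = w
      g-injective : ∀ {i j} → g i ≡ g j → i ≡ j
      g-injective {zero}             {zero}             _   = refl
      g-injective {zero}             {suc zero}         u≡v = contradiction u≡v (Adj⇒≢ u~v)
      g-injective {zero}             {suc (suc zero)}   u≡w = contradiction (sym u≡w) (Adj⇒≢ w~u)
      g-injective {suc zero}         {zero}             v≡u = contradiction (sym v≡u) (Adj⇒≢ u~v)
      g-injective {suc zero}         {suc zero}         _   = refl
      g-injective {suc zero}         {suc (suc zero)}   v≡w = contradiction v≡w (Adj⇒≢ v~w)
      g-injective {suc (suc zero)}   {zero}             w≡u = contradiction w≡u (Adj⇒≢ w~u)
      g-injective {suc (suc zero)}   {suc zero}         w≡v = contradiction (sym w≡v) (Adj⇒≢ v~w)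
      g-injective {suc (suc zero)}   {suc (suc zero)}   _   = refl
      g∈A : ∀ i → g i ∈ A
      g∈A zero             = u∈A
      g∈A (suc zero)       = v∈A
      g∈A (suc (suc zero)) = w∈A
      g-adj : ∀ (i : Fin 2) → Adj G (g (inject₁ i)) (g (suc i))
      g-adj zero       = u~v
      g-adj (suc zero) = v~w

    star⇒acyclic : ∀ c → StarIn A c → ¬ HasCycleIn G A
    star⇒acyclic c star (zero , () , _)
    star⇒acyclic c star (suc zero , s≤s () , _)
    star⇒acyclic c star (suc (suc k) , _ , f , f-injective , f∈A , f-adj , closing)
      with star (f∈A _) (f∈A _) (f-adj (suc zero)) | star (f∈A _) (f∈A _) (f-adj zero)
         | star (f∈A _) (f∈A _) closing
    ... | inj₁ f₁≡c | _         | inj₁ fₖ≡c = contradiction (f-injective (trans fₖ≡c (sym f₁≡c))) λ ()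
    ... | inj₁ f₁≡c | _         | inj₂ f₀≡c = contradiction (f-injective (trans f₀≡c (sym f₁≡c))) λ ()
    ... | inj₂ f₂≡c | inj₁ f₀≡c | _         = contradiction (f-injective (trans f₀≡c (sym f₂≡c))) λ ()
    ... | inj₂ f₂≡c | inj₂ f₁≡c | _         = contradiction (f-injective (trans f₁≡c (sym f₂≡c))) λ ()

    module _ (f : ℕ → Fin n) (f∈A : ∀ i → f i ∈ A) (f-adj : ∀ i → Adj G (f i) (f (suc i)))
             (f-nonBacktracking : ∀ i → f (suc (suc i)) ≢ f i) where

      Repeats : ℕ → Set
      Repeats j = ∃ λ i → i < j × f i ≡ f j

      repeats? : ∀ j → Dec (Repeats j)
      repeats? j with any? {n = j} (λ i → f (toℕ i) ≟ f j)
      ... | yes (i , fᵢ≡fⱼ) = yes (toℕ i , toℕ<n i , fᵢ≡fⱼ)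
      ... | no none = no λ (i , i<j , fᵢ≡fⱼ) →
        none (fromℕ< i<j , subst (λ t → f t ≡ f j) (sym (toℕ-fromℕ< i<j)) fᵢ≡fⱼ)

      -- f i, …, f (i + d) is a cycle; d ≥ 2 because G has no loops and the walk never backtracks.
      first-repeat⇒cycle : ∀ i d → f i ≡ f (suc (i + d)) → (∀ {j} → j < suc (i + d) → ¬ Repeats j) →
                           HasCycleIn G A
      first-repeat⇒cycle i zero fᵢ≡fᵢ₊₁ _ rewrite +-identityʳ i =
        ⊥-elim (Adj-irrefl (subst (λ t → Adj G t (f (suc i))) fᵢ≡fᵢ₊₁ (f-adj i)))
      first-repeat⇒cycle i (suc zero) fᵢ≡fᵢ₊₂ _ rewrite +-suc i 0 | +-identityʳ i =
        ⊥-elim (f-nonBacktracking i (sym fᵢ≡fᵢ₊₂))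
      first-repeat⇒cycle i d@(suc (suc _)) fᵢ≡fⱼ earliest =
        d , s≤s (s≤s z≤n) , g , g-injective , g∈A , g-adj , closing
        where
        g : Fin (suc d) → Fin n
        g t = f (i + toℕ t)
        i+t<j : ∀ (t : Fin (suc d)) → i + toℕ t < suc (i + d)
        i+t<j t = s≤s (+-monoʳ-≤ i (≤-pred (toℕ<n t)))
        g-injective : ∀ {t t'} → g t ≡ g t' → t ≡ t'
        g-injective {t} {t'} gₜ≡gₜ' with <-cmp (toℕ t) (toℕ t')
        ... | tri< t<t' _ _ = contradiction (i + toℕ t , +-monoʳ-< i t<t' , gₜ≡gₜ') (earliest (i+t<j t'))
        ... | tri≈ _ t≡t' _ = toℕ-injective t≡t'
        ... | tri> _ _ t>t' = contradiction (i + toℕ t' , +-monoʳ-< i t>t' , sym gₜ≡gₜ') (earliest (i+t<j t))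
        g∈A : ∀ t → g t ∈ A
        g∈A t = f∈A (i + toℕ t)
        g-adj : ∀ (t : Fin d) → Adj G (g (inject₁ t)) (g (suc t))
        g-adj t rewrite toℕ-inject₁ t | +-suc i (toℕ t) = f-adj (i + toℕ t)
        closing : Adj G (g (fromℕ d)) (g zero)
        closing rewrite toℕ-fromℕ d | +-identityʳ i = subst (Adj G (f (i + d))) (sym fᵢ≡fⱼ) (f-adj (i + d))

      repeat⇒cycle : ∀ j → Repeats j → HasCycleIn G A
      repeat⇒cycle = <-rec (λ j → Repeats j → HasCycleIn G A) from-earliest
        where
        from-earliest : ∀ j → (∀ {j'} → j' < j → Repeats j' → HasCycleIn G A) → Repeats j → HasCycleIn G A
        from-earliest j rec r with any? {n = j} (repeats? ∘ toℕ)
        ... | yes (j' , r') = rec (toℕ<n j') r'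
        ... | no none with r
        ...   | i , i<j , fᵢ≡fⱼ with m≤n⇒∃[o]m+o≡n i<j
        ...     | d , refl = first-repeat⇒cycle i d fᵢ≡fⱼ λ j'<j r' →
          none (fromℕ< j'<j , subst Repeats (sym (toℕ-fromℕ< j'<j)) r')

      nonBacktracking-walk⇒cycle : HasCycleIn G A
      nonBacktracking-walk⇒cycle with pigeonhole (n<1+n n) (f ∘ toℕ)
      ... | i , j , i<j , fᵢ≡fⱼ = repeat⇒cycle (toℕ j) (toℕ i , i<j , fᵢ≡fⱼ)

    record Arc (P : Fin n → Set) : Set where
      field
        {tail head} : Fin n
        tail∈P      : P tail
        head∈P      : P head
        adjacent    : Adj G tail head

    minDegree≥2⇒cycle : (P : Fin n → Set) → (∀ {v} → P v → v ∈ A) →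
                        (∀ {v} → P v → TwoNeighboursIn P v) → ∀ {v} → P v → HasCycleIn G A
    minDegree≥2⇒cycle P P⊆A branch {v} v∈P =
      nonBacktracking-walk⇒cycle (Arc.tail ∘ walk) (P⊆A ∘ Arc.tail∈P ∘ walk) (Arc.adjacent ∘ walk)
                                 (extend-avoids-tail ∘ walk)
      where
      extend : Arc P → Arc P
      extend a = let w , w∈P , head~w , _ = branch (Arc.head∈P a) (Arc.tail a)
                 in record { tail∈P = Arc.head∈P a ; head∈P = w∈P ; adjacent = head~w }
      extend-avoids-tail : ∀ a → Arc.head (extend a) ≢ Arc.tail a
      extend-avoids-tail a = proj₂ (proj₂ (proj₂ (branch (Arc.head∈P a) (Arc.tail a))))
      walk : ℕ → Arc P
      walk zero    = let w , w∈P , v~w , _ = branch v∈P v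
                     in record { tail∈P = v∈P ; head∈P = w∈P ; adjacent = v~w }
      walk (suc i) = extend (walk i)

  module _ {A B : Subset n} (sep : IsSeparation G A B) where

    IsSeparation-sym : IsSeparation G B A
    IsSeparation-sym = trans (∪-comm B A) (proj₁ sep) , λ u v u∈B u∉A v∈A v∉B u~v →
      proj₂ sep v u v∈A v∉B u∈B u∉A (Adj-sym u~v)

    interior-neighbour∈A : ∀ {p w} → p ∈ A → p ∉ B → Adj G p w → w ∈ A
    interior-neighbour∈A {p} {w} p∈A p∉B p~w with w ∈? A | p∪q≡⊤⇒x∈p⊎x∈q (proj₁ sep) w
    ... | yes w∈A | _        = w∈A
    ... | no w∉A  | inj₁ w∈A = contradiction w∈A w∉A
    ... | no w∉A  | inj₂ w∈B = contradiction p~w (proj₂ sep p w p∈A p∉B w∈B w∉A)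

    crossing-edge : ∀ {X p b} → WalkAvoiding G X p b → p ∈ A → p ∉ B → b ∉ A →
                    ∃ λ p' → ∃ λ q → p' ∈ A × p' ∉ B × p' ∉ X × q ∈ A ∩ B × q ∉ X × Adj G p' q
    crossing-edge (here _) p∈A _ b∉A = contradiction p∈A b∉A
    crossing-edge {p = p} (step {w = w} p∉X p~w rest) p∈A p∉B b∉A with w ∈? B
    ... | yes w∈B =
      p , w , p∈A , p∉B , p∉X , x∈p∩q⁺ (interior-neighbour∈A p∈A p∉B p~w , w∈B) , walk-head∉ rest , p~w
    ... | no w∉B  = crossing-edge rest (interior-neighbour∈A p∈A p∉B p~w) w∉B b∉A

  module ProperSeparationOfOrder3 {A B : Subset n} (conn : KConnected 3 G) (sep : IsSeparation G A B)
           {x} (x∈A : x ∈ A) (x∉B : x ∉ B) {b} (b∉A : b ∉ A) (order≡3 : ∣ A ∩ B ∣ ≡ 3) where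

    S⊆A : A ∩ B ⊆ A
    S⊆A = p∩q⊆p A B

    S⊆B : A ∩ B ⊆ B
    S⊆B = p∩q⊆q A B

    -- Removing the other two separator vertices leaves G connected, so some path from x to b
    -- must leave A ∖ B through s.
    separator-interior-neighbour : ∀ {s} → s ∈ A ∩ B → ∃ λ p → p ∈ A × p ∉ B × Adj G s p
    separator-interior-neighbour {s} s∈S with crossing-edge sep walk x∈A x∉B b∉A
      where
      X : Subset n
      X = (A ∩ B) - s
      walk : WalkAvoiding G X x b
      walk = proj₂ conn X (subst (∣ X ∣ <_) order≡3 (x∈p⇒∣p-x∣<∣p∣ s∈S)) x b
               (x∉B ∘ S⊆B ∘ p─q⊆p (A ∩ B) ⁅ s ⁆) (b∉A ∘ S⊆A ∘ p─q⊆p (A ∩ B) ⁅ s ⁆)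
    ... | p , q , p∈A , p∉B , _ , q∈S , q∉X , p~q =
      p , p∈A , p∉B , subst (λ t → Adj G t p) q≡s (Adj-sym p~q)
      where
      q≡s : q ≡ s
      q≡s = decidable-stable (q ≟ s) (q∉X ∘ x∈p∧x≢y⇒x∈p-y q∈S)

    Pendant : Fin n → Fin n → Set
    Pendant v d = d ∈ A ∩ B × (∀ {z} → z ∈ A → Adj G d z → z ≡ v)

    -- Otherwise v and the third separator vertex would separate y from b.
    ¬two-pendants : ∀ {v d d' y} → v ∈ A → Pendant v d → Pendant v d' → d ≢ d' →
                    y ∈ A → y ∉ B → y ≢ v → ⊥
    ¬two-pendants {v} {d} {d'} {y} v∈A (d∈S , d-pendant) (d'∈S , d'-pendant) d≢d' y∈A y∉B y≢v
      with crossing-edge sep (proj₂ conn X ∣X∣<3 y b y∉X b∉X) y∈A y∉B b∉A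
      where
      T : Subset n
      T = (A ∩ B) - d - d'
      X : Subset n
      X = ⁅ v ⁆ ∪ T
      T⊆S : T ⊆ A ∩ B
      T⊆S = p─q⊆p (A ∩ B) ⁅ d ⁆ ∘ p─q⊆p ((A ∩ B) - d) ⁅ d' ⁆
      ∣T∣≤1 : ∣ T ∣ ≤ 1
      ∣T∣≤1 = ≤-pred (≤-trans (x∈p⇒∣p-x∣<∣p∣ (x∈p∧x≢y⇒x∈p-y d'∈S (d≢d' ∘ sym)))
                              (≤-pred (subst (∣ (A ∩ B) - d ∣ <_) order≡3 (x∈p⇒∣p-x∣<∣p∣ d∈S))))
      ∣X∣<3 : ∣ X ∣ < 3
      ∣X∣<3 = s≤s (≤-trans (∣p∪q∣≤∣p∣+∣q∣ ⁅ v ⁆ T) (+-mono-≤ (≤-reflexive (∣⁅x⁆∣≡1 v)) ∣T∣≤1))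
      y∉X : y ∉ X
      y∉X y∈X with x∈p∪q⁻ ⁅ v ⁆ T y∈X
      ... | inj₁ y∈⁅v⁆ = y≢v (x∈⁅y⁆⇒x≡y v y∈⁅v⁆)
      ... | inj₂ y∈T   = y∉B (S⊆B (T⊆S y∈T))
      b∉X : b ∉ X
      b∉X b∈X with x∈p∪q⁻ ⁅ v ⁆ T b∈X
      ... | inj₁ b∈⁅v⁆ = b∉A (subst (_∈ A) (sym (x∈⁅y⁆⇒x≡y v b∈⁅v⁆)) v∈A)
      ... | inj₂ b∈T   = b∉A (S⊆A (T⊆S b∈T))
    ... | p , q , p∈A , _ , p∉X , q∈S , q∉X , p~q = p∉X (x∈p∪q⁺ (inj₁ (subst (_∈ ⁅ v ⁆) (sym p≡v) (x∈⁅x⁆ v))))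
      where
      p≡v : p ≡ v
      p≡v with q ≟ d | q ≟ d'
      ... | yes refl | _        = d-pendant p∈A (Adj-sym p~q)
      ... | no _     | yes refl = d'-pendant p∈A (Adj-sym p~q)
      ... | no q≢d   | no q≢d'  = ⊥-elim (q∉X (x∈p∪q⁺ (inj₂ (x∈p∧x≢y⇒x∈p-y (x∈p∧x≢y⇒x∈p-y q∈S q≢d) q≢d'))))

    -- The non-leaf vertices of G[A]; vertices of A ∖ B have degree at least 3, so all leaves lie in A ∩ B.
    Good : Fin n → Set
    Good v = v ∈ A × (v ∉ B ⊎ TwoNeighboursIn (_∈ A) v)

    good⊎pendant : ∀ {v w} → v ∈ A → w ∈ A → Adj G v w → Good w ⊎ Pendant v w
    good⊎pendant {v} {w} v∈A w∈A v~w with w ∈? B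
    ... | no w∉B = inj₁ (w∈A , inj₁ w∉B)
    ... | yes w∈B with any? (λ z → (z ∈? A) ×-dec (adj? w z) ×-dec ¬? (z ≟ v))
    ...   | yes (z , z∈A , w~z , z≢v) = inj₁ (w∈A , inj₂ (two-neighbours z∈A w~z v∈A (Adj-sym v~w) z≢v))
    ...   | no none = inj₂ (x∈p∩q⁺ (w∈A , w∈B) , λ {z} z∈A w~z →
                              decidable-stable (z ≟ v) (λ z≢v → none (z , z∈A , w~z , z≢v)))

    TwoInteriorVertices : Set
    TwoInteriorVertices = ∀ v → ∃ λ y → y ∈ A × y ∉ B × y ≢ v

    interior-step : TwoInteriorVertices → ∀ {v} → v ∈ A → v ∉ B → TwoNeighboursIn Good v
    interior-step wide {v} v∈A v∉B u with neighbour-avoiding conn v u u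
    ... | w₁ , v~w₁ , w₁≢u , _ with neighbour-avoiding conn v u w₁
    ... | w₂ , v~w₂ , w₂≢u , w₂≢w₁
      with good⊎pendant v∈A (interior-neighbour∈A sep v∈A v∉B v~w₁) v~w₁
         | good⊎pendant v∈A (interior-neighbour∈A sep v∈A v∉B v~w₂) v~w₂
    ... | inj₁ w₁-good | _            = w₁ , w₁-good , v~w₁ , w₁≢u
    ... | inj₂ _       | inj₁ w₂-good = w₂ , w₂-good , v~w₂ , w₂≢u
    ... | inj₂ pendant₁ | inj₂ pendant₂ =
      let y , y∈A , y∉B , y≢v = wide v
      in ⊥-elim (¬two-pendants v∈A pendant₁ pendant₂ (w₂≢w₁ ∘ sym) y∈A y∉B y≢v)

    separator-step : ∀ {v} → v ∈ A → v ∈ B → TwoNeighboursIn (_∈ A) v → TwoNeighboursIn Good v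
    separator-step {v} v∈A v∈B two u with two u
    ... | w , w∈A , v~w , w≢u with w ∈? B
    ...   | no w∉B  = w , (w∈A , inj₁ w∉B) , v~w , w≢u
    ...   | yes w∈B =
      let p , p∈A , p∉B , w~p = separator-interior-neighbour (x∈p∩q⁺ (w∈A , w∈B))
          p≢v = λ p≡v → p∉B (subst (_∈ B) (sym p≡v) v∈B)
      in w , (w∈A , inj₂ (two-neighbours p∈A w~p v∈A (Adj-sym v~w) p≢v)) , v~w , w≢u

    good-step : TwoInteriorVertices → ∀ {v} → Good v → TwoNeighboursIn Good v
    good-step wide {v} (v∈A , v-good) with v ∈? B | v-good
    ... | no v∉B  | _         = interior-step wide v∈A v∉B
    ... | yes v∈B | inj₁ v∉B  = contradiction v∈B v∉B
    ... | yes v∈B | inj₂ two  = separator-step v∈A v∈B two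

    unique-interior⇒adjacent : (∀ {y} → y ∈ A → y ∉ B → y ≡ x) → ∀ {s} → s ∈ A ∩ B → Adj G x s
    unique-interior⇒adjacent unique s∈S =
      let p , p∈A , p∉B , s~p = separator-interior-neighbour s∈S
      in Adj-sym (subst (Adj G _) (unique p∈A p∉B) s~p)

    unique-interior⇒claw⊎cycle : (∀ {y} → y ∈ A → y ∉ B → y ≡ x) → IsClawWithLeaves G A (A ∩ B) ⊎ HasCycleIn G A
    unique-interior⇒claw⊎cycle unique
      with any? (λ s → any? (λ s' → (s ∈? (A ∩ B)) ×-dec (s' ∈? (A ∩ B)) ×-dec adj? s s'))
    ... | yes (s , s' , s∈S , s'∈S , s~s') =
      inj₂ (triangle⇒cycle x∈A (S⊆A s∈S) (S⊆A s'∈S) (x~ s∈S) s~s' (Adj-sym (x~ s'∈S)))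
      where
      x~ : ∀ {s} → s ∈ A ∩ B → Adj G x s
      x~ = unique-interior⇒adjacent unique
    ... | no none = inj₁ (order≡3 , x , x∉B ∘ S⊆B , x-or-leaf , x∈A , (λ _ → S⊆A) , edges)
      where
      x-or-leaf : ∀ y → y ∈ A → y ≡ x ⊎ y ∈ A ∩ B
      x-or-leaf y y∈A with y ∈? B
      ... | yes y∈B = inj₂ (x∈p∩q⁺ (y∈A , y∈B))
      ... | no y∉B  = inj₁ (unique y∈A y∉B)
      ClawEdge : Fin n → Fin n → Set
      ClawEdge y z = (y ≡ x × z ∈ A ∩ B) ⊎ (z ≡ x × y ∈ A ∩ B)
      edges : ∀ y z → y ∈ A → z ∈ A → (Adj G y z → ClawEdge y z) × (ClawEdge y z → Adj G y z)
      edges y z y∈A z∈A = star-edge , λ where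
          (inj₁ (refl , z∈S)) → unique-interior⇒adjacent unique z∈S
          (inj₂ (refl , y∈S)) → Adj-sym (unique-interior⇒adjacent unique y∈S)
        where
        star-edge : Adj G y z → ClawEdge y z
        star-edge y~z with x-or-leaf y y∈A | x-or-leaf z z∈A
        ... | inj₁ refl | inj₁ refl = ⊥-elim (Adj-irrefl y~z)
        ... | inj₁ y≡x  | inj₂ z∈S  = inj₁ (y≡x , z∈S)
        ... | inj₂ y∈S  | inj₁ z≡x  = inj₂ (z≡x , y∈S)
        ... | inj₂ y∈S  | inj₂ z∈S  = ⊥-elim (none (y , z , y∈S , z∈S , y~z))

    claw⊎cycle : IsClawWithLeaves G A (A ∩ B) ⊎ HasCycleIn G A
    claw⊎cycle with any? (λ y → (y ∈? A) ×-dec ¬? (y ∈? B) ×-dec ¬? (y ≟ x))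
    ... | yes (y , y∈A , y∉B , y≢x) = inj₂ (minDegree≥2⇒cycle Good proj₁ (good-step wide) (x∈A , inj₁ x∉B))
      where
      wide : TwoInteriorVertices
      wide v with y ≟ v
      ... | yes refl = x , x∈A , x∉B , y≢x ∘ sym
      ... | no y≢v   = y , y∈A , y∉B , y≢v
    ... | no none = unique-interior⇒claw⊎cycle λ {y} y∈A y∉B →
      decidable-stable (y ≟ x) (λ y≢x → none (y , y∈A , y∉B , y≢x))

  claw⇒star : ∀ {A L} → IsClawWithLeaves G A L → ∃ λ c → c ∉ L × StarIn A c
  claw⇒star (_ , c , c∉L , _ , _ , _ , edges) =
    c , c∉L , λ x∈A y∈A x~y → Sum.map proj₁ proj₁ (proj₁ (edges _ _ x∈A y∈A) x~y)

  claw⇒acyclic : ∀ {A L} → IsClawWithLeaves G A L → ¬ HasCycleIn G A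
  claw⇒acyclic claw = let c , _ , star = claw⇒star claw in star⇒acyclic c star

  star-leaf-neighbour : ∀ {A L c s w} → StarIn A c → c ∉ L → s ∈ L → s ∈ A → w ∈ A → Adj G s w → w ≡ c
  star-leaf-neighbour star c∉L s∈L s∈A w∈A s~w with star s∈A w∈A s~w
  ... | inj₁ refl = contradiction s∈L c∉L
  ... | inj₂ w≡c  = w≡c

  -- A leaf has a third neighbour besides the two centres, and that neighbour lies in A or in B.
  ¬claw×claw : ∀ {A B L} → KConnected 3 G → A ∪ B ≡ ⊤ → IsClawWithLeaves G A L → IsClawWithLeaves G B L → ⊥
  ¬claw×claw {L = L} 3-connected A∪B≡⊤
             clawA@(∣L∣≡3 , _ , _ , _ , _ , L⊆A , _) clawB@(_ , _ , _ , _ , _ , L⊆B , _)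
    with claw⇒star clawA | claw⇒star clawB
       | ∣q∣<∣p∣⇒p⊈q L ∅ (subst₂ _<_ (sym (∣⊥∣≡0 n)) (sym ∣L∣≡3) (s≤s z≤n))
  ... | c , c∉L , starA | d , d∉L , starB | s , s∈L , _
    with neighbour-avoiding 3-connected s c d
  ... | w , s~w , w≢c , w≢d with p∪q≡⊤⇒x∈p⊎x∈q A∪B≡⊤ w
  ...   | inj₁ w∈A = w≢c (star-leaf-neighbour starA c∉L s∈L (L⊆A s s∈L) w∈A s~w)
  ...   | inj₂ w∈B = w≢d (star-leaf-neighbour starB d∉L s∈L (L⊆B s s∈L) w∈B s~w)

open ProperSeparationOfOrder3 using (claw⊎cycle)

lemma3p1 : ∀ {n : ℕ} (G : Graph n) (A B : Subset n) →
    KConnected 3 G → IsSeparation G A B → IsProper A B → order A B ≡ 3 →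
    let C1 = (IsClawWithLeaves G A (A ∩ B) × HasCycleIn G B)
               ⊎ (IsClawWithLeaves G B (A ∩ B) × HasCycleIn G A)
        C2 = HasCycleIn G A × HasCycleIn G B
    in (C1 ⊎ C2) × ¬ (C1 × C2)
lemma3p1 G A B 3-connected sep ((x , x∈A , x∉B) , (y , y∈B , y∉A)) ∣A∩B∣≡3
  with claw⊎cycle G 3-connected sep x∈A x∉B y∉A ∣A∩B∣≡3
     | subst (λ S → IsClawWithLeaves G B S ⊎ HasCycleIn G B) (∩-comm B A)
         (claw⊎cycle G 3-connected (IsSeparation-sym G sep) y∈B y∉A x∉B (trans (cong ∣_∣ (∩-comm B A)) ∣A∩B∣≡3))
... | inj₁ clawA  | inj₁ clawB  = ⊥-elim (¬claw×claw G 3-connected (proj₁ sep) clawA clawB)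
... | inj₁ clawA  | inj₂ cycleB = inj₁ (inj₁ (clawA , cycleB)) , λ (_ , cycleA , _) → claw⇒acyclic G clawA cycleA
... | inj₂ cycleA | inj₁ clawB  = inj₁ (inj₂ (clawB , cycleA)) , λ (_ , _ , cycleB) → claw⇒acyclic G clawB cycleB
... | inj₂ cycleA | inj₂ cycleB = inj₂ (cycleA , cycleB) , λ where
  (inj₁ (clawA , _) , _) → claw⇒acyclic G clawA cycleA
  (inj₂ (clawB , _) , _) → claw⇒acyclic G clawB cycleB
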